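{- Let $q\ge2$ be a power of a prime, $s$ an integer with $1<s<q$ and $\bar{s}=q-s$. For integers $j\geq 2$, $1\leq n\leq q^{j-1}+1$ and $m\geq n$, the number $b_{j,m,n}$ (defined in the context) satisfies $$[\bar{s}^{j+m-n}]_q\le b_{j,m,n}\le[1^{j+m-n}0]_q.$$
   Context: For a word $w$ over $\{0,\dots,q-1\}$, $[w]_q$ is the integer whose base-$q$ expansion is $w$, and $x^m$ denotes $m$ copies of the letter $x$ (so $[1^00]_q=0$). Decomposition procedure: given a positive integer $b$, set $b_1=b$. Inductively, if $b_i$ has been defined and $b_i\ge q-1$, let $l_i=\max\{l\in\mathbb{N}^*: b_i\geq q^l-1\}$; if $b_i-(q^{l_i}-1)>[1^{l_i-1}0]_q$ the procedure stops, otherwise set $b_{i+1}=b_i-(q^{l_i}-1)$ and continue. If $b_i<q-1$ the procedure stops. For $j,m\in\mathbb{N}^*$, $b_{j,m,n}$ denotes the term $b_n$ produced by this procedure with input $b_1=[1^m0^j]_q$ (undefined if the procedure stops before producing $b_n$). -}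

module Defs where

open import Data.Nat using (ℕ; zero; suc; _+_; _*_; _∸_; _^_; _≤_; _<_)
open import Data.List using (List; []; _∷_; _++_; replicate; foldl)
open import Data.Product using (_×_)

[_]_ : List ℕ → ℕ → ℕ
[ w ] q = foldl (λ acc d → acc * q + d) 0 w

_^^_ : ℕ → ℕ → List ℕ
x ^^ m = replicate m x

IsMaxL : ℕ → ℕ → ℕ → Set
IsMaxL q b l = (1 ≤ l) × (q ^ l ∸ 1 ≤ b) × (∀ l' → 1 ≤ l' → q ^ l' ∸ 1 ≤ b → l' ≤ l)

-- Decomp q b n c : the decomposition procedure with input b₁ = b produces
-- the term b_n, and b_n = c  (indices start at 1).
data Decomp (q b : ℕ) : ℕ → ℕ → Set where
  first : Decomp q b 1 b
  step  : ∀ {n c l} → Decomp q b n c → q ∸ 1 ≤ c → IsMaxL q c l →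
          c ∸ (q ^ l ∸ 1) ≤ [ (1 ^^ (l ∸ 1)) ++ (0 ∷ []) ] q →
          Decomp q b (suc n) (c ∸ (q ^ l ∸ 1))

-- Writing R k for the repunit [1^k]_q and j = i + 1, the procedure started at [1^m 0^j]_q
-- passes through b_{t+1} = R (m - t) · q^j + t.  Indeed R (u + 2) · q^j + t is
-- (q^(u+1+j) - 1) + (R (u + 1) · q^j + t + 1), where u + 1 + j is the maximal admissible
-- exponent and the remainder is at most [1^(u+j) 0]_q as long as t + 1 ≤ q^i.
-- Both bounds then follow from [x^k]_q < q^k ≤ R (k + 1) for digits x < q.
module Submission where

open import Defs
open import Data.Nat using (ℕ; zero; suc; _+_; _*_; _∸_; _^_; _≤_; _<_; s≤s; z≤n; z<s; _≤?_; NonZero; >-nonZero)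
open import Data.Nat.Properties
open import Data.Nat.Primality using (Prime)
open import Data.Nat.Solver using (module +-*-Solver)
open import Data.List using (List; []; _∷_; _++_; foldl)
open import Data.List.Properties using (foldl-++)
open import Data.Product using (_×_; ∃-syntax; _,_)
open import Relation.Binary.PropositionalEquality using (_≡_; refl; sym; trans; cong; subst; module ≡-Reasoning)
open import Relation.Nullary using (yes; no; contradiction)
open +-*-Solver using (solve; _:=_; _:+_; _:*_; con)

j+[n+u]∸n≡u+j : ∀ j n u → j + (n + u) ∸ n ≡ u + j
j+[n+u]∸n≡u+j j n u = trans
  (cong (_∸ n) (solve 3 (λ j n u → j :+ (n :+ u) := (u :+ j) :+ n) refl j n u))
  (m+n∸n≡m (u + j) n)

module Digits (q : ℕ) where

  horner : ℕ → List ℕ → ℕ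
  horner a w = foldl (λ acc d → acc * q + d) a w

  repunit : ℕ → ℕ
  repunit k = [ 1 ^^ k ] q

  [++]≡horner : ∀ v w → [ v ++ w ] q ≡ horner ([ v ] q) w
  [++]≡horner = foldl-++ _ 0

  horner-replicate : ∀ a k x → horner a (x ^^ k) ≡ a * q ^ k + [ x ^^ k ] q
  horner-replicate a zero x = sym (trans (+-identityʳ _) (*-identityʳ a))
  horner-replicate a (suc k) x = begin
    horner (a * q + x) (x ^^ k)                  ≡⟨ horner-replicate (a * q + x) k x ⟩
    (a * q + x) * p + [ x ^^ k ] q
      ≡⟨ solve 5 (λ a q x p r → (a :* q :+ x) :* p :+ r := a :* (q :* p) :+ (x :* p :+ r))
               refl a q x p ([ x ^^ k ] q) ⟩
    a * (q * p) + (x * p + [ x ^^ k ] q)         ≡⟨ cong (a * (q * p) +_) (sym (horner-replicate x k x)) ⟩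
    a * (q * p) + horner x (x ^^ k)              ∎
    where
    open ≡-Reasoning
    p = q ^ k

  horner-replicate-+ : ∀ a b k x → horner a (x ^^ (b + k)) ≡ horner (horner a (x ^^ b)) (x ^^ k)
  horner-replicate-+ a zero    k x = refl
  horner-replicate-+ a (suc b) k x = horner-replicate-+ (a * q + x) b k x

  [0^k]≡0 : ∀ k → [ 0 ^^ k ] q ≡ 0
  [0^k]≡0 zero    = refl
  [0^k]≡0 (suc k) = [0^k]≡0 k

  [1^m0^j]≡repunit*q^j : ∀ m j → [ (1 ^^ m) ++ (0 ^^ j) ] q ≡ repunit m * q ^ j
  [1^m0^j]≡repunit*q^j m j = begin
    [ (1 ^^ m) ++ (0 ^^ j) ] q            ≡⟨ [++]≡horner (1 ^^ m) (0 ^^ j) ⟩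
    horner (repunit m) (0 ^^ j)           ≡⟨ horner-replicate (repunit m) j 0 ⟩
    repunit m * q ^ j + [ 0 ^^ j ] q      ≡⟨ cong (repunit m * q ^ j +_) ([0^k]≡0 j) ⟩
    repunit m * q ^ j + 0                 ≡⟨ +-identityʳ _ ⟩
    repunit m * q ^ j                     ∎
    where open ≡-Reasoning

  [1^k0]≡repunit*q : ∀ k → [ (1 ^^ k) ++ (0 ∷ []) ] q ≡ repunit k * q
  [1^k0]≡repunit*q k = trans ([++]≡horner (1 ^^ k) (0 ∷ [])) (+-identityʳ _)

  repunit-+ : ∀ a k → repunit (a + k) ≡ repunit a * q ^ k + repunit k
  repunit-+ a k = trans (horner-replicate-+ 0 a k 1) (horner-replicate (repunit a) k 1)

  repunit-suc : ∀ k → repunit (suc k) ≡ q ^ k + repunit k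
  repunit-suc k = trans (repunit-+ 1 k) (cong (_+ repunit k) (*-identityˡ (q ^ k)))

  q^k≤repunit[1+k] : ∀ k → q ^ k ≤ repunit (suc k)
  q^k≤repunit[1+k] k = ≤-trans (m≤m+n (q ^ k) (repunit k)) (≤-reflexive (sym (repunit-suc k)))

  [x^k]<q^k : ∀ k {x} → x < q → [ x ^^ k ] q < q ^ k
  [x^k]<q^k zero    x<q = s≤s z≤n
  [x^k]<q^k (suc k) {x} x<q = begin-strict
    horner x (x ^^ k)          ≡⟨ horner-replicate x k x ⟩
    x * q ^ k + [ x ^^ k ] q   <⟨ +-monoʳ-< (x * q ^ k) ([x^k]<q^k k x<q) ⟩
    x * q ^ k + q ^ k          ≡⟨ +-comm (x * q ^ k) (q ^ k) ⟩
    suc x * q ^ k              ≤⟨ *-monoˡ-≤ (q ^ k) x<q ⟩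
    q * q ^ k                  ∎
    where open ≤-Reasoning

  [x^[k+j]]<repunit[1+k]*q^j : ∀ k j {x} → x < q → [ x ^^ (k + j) ] q < repunit (suc k) * q ^ j
  [x^[k+j]]<repunit[1+k]*q^j k j x<q = begin-strict
    [ _ ^^ (k + j) ] q      <⟨ [x^k]<q^k (k + j) x<q ⟩
    q ^ (k + j)             ≡⟨ ^-distribˡ-+-* q k j ⟩
    q ^ k * q ^ j           ≤⟨ *-monoˡ-≤ (q ^ j) (q^k≤repunit[1+k] k) ⟩
    repunit (suc k) * q ^ j ∎
    where open ≤-Reasoning

  repunit*q^[1+i]+x≤repunit*q : ∀ u {i x} → 1 ≤ i → x ≤ q ^ i →
                             repunit (suc u) * q ^ suc i + x ≤ repunit (u + suc i) * q
  repunit*q^[1+i]+x≤repunit*q u {suc k} {x} _ x≤q^i = begin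
    r * (q * p) + x                   ≤⟨ +-monoʳ-≤ (r * (q * p)) (≤-trans x≤q^i q^i≤repunit*q) ⟩
    r * (q * p) + repunit (suc k) * q ≡⟨ solve 4 (λ r q p s → r :* (q :* p) :+ s :* q := (r :* p :+ s) :* q)
                                                 refl r q p (repunit (suc k)) ⟩
    (r * p + repunit (suc k)) * q     ≡⟨ cong (_* q) (sym (repunit-+ (suc u) (suc k))) ⟩
    repunit (suc u + suc k) * q       ≡⟨ cong (λ n → repunit n * q) (sym (+-suc u (suc k))) ⟩
    repunit (u + suc (suc k)) * q     ∎
    where
    open ≤-Reasoning
    r = repunit (suc u)
    p = q ^ suc k
    q^i≤repunit*q : q ^ suc k ≤ repunit (suc k) * q
    q^i≤repunit*q = ≤-trans (*-monoʳ-≤ q (q^k≤repunit[1+k] k)) (≤-reflexive (*-comm q _))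

module Decomposition (q : ℕ) (1<q : 1 < q) where
  open Digits q

  private instance
    q-nonZero : NonZero q
    q-nonZero = >-nonZero (<⇒≤ 1<q)

  isMaxL : ∀ {c l} → 1 ≤ l → q ^ l ∸ 1 ≤ c → suc c < q ^ suc l → IsMaxL q c l
  isMaxL {c} {l} 1≤l lower upper = 1≤l , lower , maximal
    where
    maximal : ∀ l' → 1 ≤ l' → q ^ l' ∸ 1 ≤ c → l' ≤ l
    maximal l' _ q^l'∸1≤c with l' ≤? l
    ... | yes l'≤l = l'≤l
    ... | no  l'≰l = contradiction
      (≤-trans (∸-monoˡ-≤ 1 (^-monoʳ-≤ q (≰⇒> l'≰l))) q^l'∸1≤c)
      (<⇒≱ (∸-monoˡ-≤ 1 upper))

  Decomp-subtract : ∀ {b n l} x → Decomp q b n (q ^ l ∸ 1 + x) → 1 ≤ l →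
                    suc (q ^ l ∸ 1 + x) < q ^ suc l →
                    x ≤ [ (1 ^^ (l ∸ 1)) ++ (0 ∷ []) ] q → Decomp q b (suc n) x
  Decomp-subtract {b} {n} {l} x d 1≤l upper x≤ =
    subst (Decomp q b (suc n)) leaves-x
      (step d q∸1≤c (isMaxL 1≤l (m≤m+n (q ^ l ∸ 1) x) upper) (subst (_≤ _) (sym leaves-x) x≤))
    where
    leaves-x : q ^ l ∸ 1 + x ∸ (q ^ l ∸ 1) ≡ x
    leaves-x = m+n∸m≡n (q ^ l ∸ 1) x
    q∸1≤c : q ∸ 1 ≤ q ^ l ∸ 1 + x
    q∸1≤c = ≤-trans (∸-monoˡ-≤ 1 (≤-trans (≤-reflexive (sym (^-identityʳ q))) (^-monoʳ-≤ q 1≤l)))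
                    (m≤m+n _ x)

  repunit-peel : ∀ k j t → repunit (suc k) * q ^ j + t ≡ (q ^ (k + j) ∸ 1) + (repunit k * q ^ j + suc t)
  repunit-peel k j t = begin
    repunit (suc k) * q ^ j + t          ≡⟨ cong (λ r → r * q ^ j + t) (repunit-suc k) ⟩
    (q ^ k + repunit k) * q ^ j + t      ≡⟨ solve 4 (λ a b z t → (a :+ b) :* z :+ t := a :* z :+ (b :* z :+ t))
                                                    refl (q ^ k) (repunit k) (q ^ j) t ⟩
    q ^ k * q ^ j + (repunit k * q ^ j + t) ≡⟨ cong (_+ rest) (sym (^-distribˡ-+-* q k j)) ⟩
    q ^ (k + j) + (repunit k * q ^ j + t)   ≡⟨ cong (_+ rest) (sym (m∸n+n≡m (m^n>0 q (k + j)))) ⟩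
    (q ^ (k + j) ∸ 1) + 1 + (repunit k * q ^ j + t)
      ≡⟨ solve 3 (λ p a t → p :+ con 1 :+ (a :+ t) := p :+ (a :+ (con 1 :+ t)))
               refl (q ^ (k + j) ∸ 1) (repunit k * q ^ j) t ⟩
    (q ^ (k + j) ∸ 1) + (repunit k * q ^ j + suc t) ∎
    where
    open ≡-Reasoning
    rest = repunit k * q ^ j + t

  repunit*q^j+x<q^[k+j] : ∀ k j {x} → x < q ^ j → repunit k * q ^ j + x < q ^ (k + j)
  repunit*q^j+x<q^[k+j] k j {x} x<q^j = begin-strict
    repunit k * q ^ j + x       <⟨ +-monoʳ-< (repunit k * q ^ j) x<q^j ⟩
    repunit k * q ^ j + q ^ j   ≡⟨ +-comm (repunit k * q ^ j) (q ^ j) ⟩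
    suc (repunit k) * q ^ j     ≤⟨ *-monoˡ-≤ (q ^ j) ([x^k]<q^k k 1<q) ⟩
    q ^ k * q ^ j               ≡⟨ sym (^-distribˡ-+-* q k j) ⟩
    q ^ (k + j)                 ∎
    where open ≤-Reasoning

  trajectory : ∀ {b} i t u → 1 ≤ i → t ≤ q ^ i → b ≡ repunit (suc t + u) * q ^ suc i →
               Decomp q b (suc t) (repunit (suc u) * q ^ suc i + t)
  trajectory i zero u _ _ b≡ = subst (Decomp q _ 1) (trans b≡ (sym (+-identityʳ _))) first
  trajectory i (suc t) u 1≤i 1+t≤q^i b≡ =
    Decomp-subtract {l = suc u + suc i} (repunit (suc u) * q ^ suc i + suc t)
      (subst (Decomp q _ (suc t)) (repunit-peel (suc u) (suc i) t) previous)
      (s≤s z≤n)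
      (subst (_< q ^ suc (suc u + suc i))
             (trans (+-suc (repunit (suc (suc u)) * q ^ suc i) t) (cong suc (repunit-peel (suc u) (suc i) t)))
             (repunit*q^j+x<q^[k+j] (suc (suc u)) (suc i) 1+t<q^[1+i]))
      (subst (repunit (suc u) * q ^ suc i + suc t ≤_) (sym ([1^k0]≡repunit*q (u + suc i)))
             (repunit*q^[1+i]+x≤repunit*q u 1≤i 1+t≤q^i))
    where
    previous : Decomp q _ (suc t) (repunit (suc (suc u)) * q ^ suc i + t)
    previous = trajectory i t (suc u) 1≤i (<⇒≤ 1+t≤q^i)
                 (trans b≡ (cong (λ n → repunit (suc n) * q ^ suc i) (sym (+-suc t u))))
    1+t<q^[1+i] : suc t < q ^ suc i
    1+t<q^[1+i] = ≤-<-trans 1+t≤q^i (^-monoʳ-< q 1<q (n<1+n i))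

  bounds : ∀ i t m {x} → 1 ≤ i → t ≤ q ^ i → t < m → x < q →
    ∃[ c ] (Decomp q ([ (1 ^^ m) ++ (0 ^^ suc i) ] q) (suc t) c ×
            [ x ^^ (suc i + m ∸ suc t) ] q ≤ c ×
            c ≤ [ (1 ^^ (suc i + m ∸ suc t)) ++ (0 ∷ []) ] q)
  bounds i t m 1≤i t≤q^i t<m x<q with m ∸ suc t | m+[n∸m]≡n t<m
  ... | u | refl rewrite j+[n+u]∸n≡u+j (suc i) (suc t) u =
      repunit (suc u) * q ^ suc i + t
    , trajectory i t u 1≤i t≤q^i ([1^m0^j]≡repunit*q^j (suc t + u) (suc i))
    , ≤-trans (<⇒≤ ([x^[k+j]]<repunit[1+k]*q^j u (suc i) x<q)) (m≤m+n _ t)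
    , subst (repunit (suc u) * q ^ suc i + t ≤_) (sym ([1^k0]≡repunit*q (u + suc i)))
            (repunit*q^[1+i]+x≤repunit*q u 1≤i t≤q^i)

corollary2 : (q : ℕ) → 2 ≤ q → (∃[ p ] ∃[ k ] (Prime p × q ≡ p ^ k)) →
    (s : ℕ) → 1 < s → s < q →
    (j n m : ℕ) → 2 ≤ j → 1 ≤ n → n ≤ q ^ (j ∸ 1) + 1 → n ≤ m →
    ∃[ c ] (Decomp q ([ (1 ^^ m) ++ (0 ^^ j) ] q) n c ×
            [ (q ∸ s) ^^ (j + m ∸ n) ] q ≤ c ×
            c ≤ [ (1 ^^ (j + m ∸ n)) ++ (0 ∷ []) ] q)
corollary2 q 1<q _ s 1<s s<q (suc i) (suc t) m (s≤s 1≤i) _ 1+t≤q^i+1 1+t≤m =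
  Decomposition.bounds q 1<q i t m 1≤i t≤q^i 1+t≤m q∸s<q
  where
  t≤q^i : t ≤ q ^ i
  t≤q^i = ≤-pred (subst (suc t ≤_) (+-comm (q ^ i) 1) 1+t≤q^i+1)
  q∸s<q : q ∸ s < q
  q∸s<q = ∸-monoʳ-< (<-trans z<s 1<s) (<⇒≤ s<q)
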